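{- Let $P\subseteq\mathbb{R}^d$ be a lattice polytope. If $P$ is $2$-convex-normal, then $P$ has the integer decomposition property.
   Context: A lattice polytope is the convex hull of finitely many points of $\mathbb{Z}^d$. For a polytope $Q$ with vertex set $\mathrm{ver}(Q)$ set $G(Q):=\bigcup_{v\in\mathrm{ver}(Q)}\big((v+\mathbb{Z}^d)\cap Q\big)$. A rational polytope $P$ is $k$-convex-normal if for all rational $c\in[2,k]$, $cP=G((c-1)P)+P$; in particular $P$ is $2$-convex-normal iff $2P=G(P)+P$. A lattice polytope $P$ has the integer decomposition property if for all $k\in\mathbb{N}$ and all $z\in kP\cap\mathbb{Z}^d$ there exist $x_1,\dots,x_k\in P\cap\mathbb{Z}^d$ with $z=x_1+\dots+x_k$. -}

module Defs where

open import Data.Nat as ℕ using (ℕ; zero; suc)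
open import Data.Integer as ℤ using (ℤ)
open import Data.Rational using (ℚ; 0ℚ; 1ℚ; _+_; _*_; _-_; _≤_; _<_; _/_)
open import Data.Fin using (Fin; zero; suc)
open import Data.Product using (Σ; ∃; _×_; _,_)
open import Relation.Binary.PropositionalEquality using (_≡_)

-- Points of ℚ^d (the rational points of ℝ^d) and of ℤ^d
Point : ℕ → Set
Point d = Fin d → ℚ

LPoint : ℕ → Set
LPoint d = Fin d → ℤ

Region : ℕ → Set₁
Region d = Point d → Set

ι : ℤ → ℚ
ι z = z / 1

ιᵈ : ∀ {d} → LPoint d → Point d
ιᵈ z i = ι (z i)

_≈_ : ∀ {d} → Point d → Point d → Set
x ≈ y = ∀ i → x i ≡ y i
infix 4 _≈_

_⊕_ : ∀ {d} → Point d → Point d → Point d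
(x ⊕ y) i = x i + y i

_⊖_ : ∀ {d} → Point d → Point d → Point d
(x ⊖ y) i = x i - y i

_·_ : ∀ {d} → ℚ → Point d → Point d
(c · x) i = c * x i

𝟎 : ∀ {d} → Point d
𝟎 i = 0ℚ

sumℚ : ∀ {n} → (Fin n → ℚ) → ℚ
sumℚ {zero}  f = 0ℚ
sumℚ {suc n} f = f zero + sumℚ (λ i → f (suc i))

sumPt : ∀ {d n} → (Fin n → Point d) → Point d
sumPt {d} {zero}  f = 𝟎
sumPt {d} {suc n} f = f zero ⊕ sumPt (λ i → f (suc i))

IsLattice : ∀ {d} → Point d → Set
IsLattice {d} x = Σ (LPoint d) λ z → x ≈ ιᵈ z

Conv : ∀ {d n} → (Fin n → LPoint d) → Region d
Conv {d} {n} V x =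
  Σ (Fin n → ℚ) λ λs →
    (∀ i → 0ℚ ≤ λs i) × (sumℚ λs ≡ 1ℚ) × (x ≈ sumPt (λ i → λs i · ιᵈ (V i)))

_⊆_ : ∀ {d} → Region d → Region d → Set
A ⊆ B = ∀ x → A x → B x

_≐_ : ∀ {d} → Region d → Region d → Set
A ≐ B = (A ⊆ B) × (B ⊆ A)

_⋆_ : ∀ {d} → ℚ → Region d → Region d
(c ⋆ Q) x = Σ _ λ q → Q q × (x ≈ c · q)

_⊞_ : ∀ {d} → Region d → Region d → Region d
(A ⊞ B) x = Σ _ λ a → Σ _ λ b → A a × B b × (x ≈ a ⊕ b)

IsVertex : ∀ {d} → Region d → Point d → Set
IsVertex Q v =
  Q v × (∀ x y t → Q x → Q y → 0ℚ < t → t < 1ℚ →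
           v ≈ (t · x) ⊕ ((1ℚ - t) · y) → x ≈ v)

G : ∀ {d} → Region d → Region d
G Q x = Q x × Σ _ λ v → IsVertex Q v × IsLattice (x ⊖ v)

ConvexNormal : ∀ {d} → ℚ → Region d → Set
ConvexNormal k P =
  ∀ c → (2ℚ ≤ c) → c ≤ k → (c ⋆ P) ≐ (G ((c - 1ℚ) ⋆ P) ⊞ P)
  where 2ℚ = ℤ.+ 2 / 1

IDP : ∀ {d} → Region d → Set
IDP {d} P =
  ∀ (k : ℕ) → 1 ℕ.≤ k → (z : LPoint d) → ((ℤ.+ k / 1) ⋆ P) (ιᵈ z) →
    Σ (Fin k → LPoint d) λ xs →
      (∀ i → P (ιᵈ (xs i))) × (ιᵈ z ≈ sumPt (λ i → ιᵈ (xs i)))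

module Submission where

-- Let P = conv(V₀,…,V_{n-1}) and let z be a lattice point of (m+2)P,
-- say z = (m+2)p with p ∈ P.  Convex-normality at c = 2 writes
-- 2p = a + b with a ∈ G(P) and b ∈ P.  Every vertex of P is one of the
-- generators Vᵢ, hence a lattice point, so a (a vertex plus a lattice
-- vector) is a lattice point of P.  The remainder
--     z - a = m·p + (2p - a) = m·p + b = (m+1)·(m/(m+1)·p + 1/(m+1)·b)
-- is a lattice point of (m+1)P, and induction on the dilation factor
-- splits it further.

open import Defs
open import Data.Nat using (ℕ)
open import Data.Integer using (+_)
open import Data.Rational using (_/_)
open import Data.Fin using (Fin)

import Data.Nat as ℕ
import Data.Nat.Properties as ℕP
import Data.Nat.Coprimality as Coprime
open import Data.Integer as ℤ using (ℤ)
import Data.Integer.Properties as ℤP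
open import Data.Rational as ℚ using (ℚ; mkℚ; 0ℚ; 1ℚ; _+_; _*_; _-_; -_; _≤_; _<_; 1/_)
import Data.Rational.Properties as ℚP
open import Data.Fin using (zero; suc)
open import Data.Vec.Functional using (tail; _∷_)
open import Function using (_∘_)
open import Data.Product using (Σ; _×_; _,_; proj₁; proj₂)
open import Relation.Binary.PropositionalEquality
open import Relation.Binary.Definitions using (tri<; tri≈; tri>)
open import Data.Empty using (⊥-elim)
open import Data.Rational.Solver using (module +-*-Solver)
open +-*-Solver
open ≡-Reasoning

ι-as-mkℚ : ∀ z → ι z ≡ mkℚ z 0 (Coprime.sym (Coprime.1-coprimeTo ℤ.∣ z ∣))
ι-as-mkℚ z = ℚP.↥p/↧p≡p _

-- ι is additive: on denominator-1 fractions, rational addition reduces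
-- to (a·1 + b·1)/1.
ι-+ : ∀ a b → ι (a ℤ.+ b) ≡ ι a + ι b
ι-+ a b = trans (cong₂ (λ x y → ι (x ℤ.+ y)) (sym (ℤP.*-identityʳ a)) (sym (ℤP.*-identityʳ b)))
                (sym (cong₂ _+_ (ι-as-mkℚ a) (ι-as-mkℚ b)))

ι-suc : ∀ m → ι (+ ℕ.suc m) ≡ ι (+ m) + 1ℚ
ι-suc m = trans (cong (λ k → ι (+ k)) (ℕP.+-comm 1 m)) (ι-+ (+ m) (+ 1))

ι-- : ∀ x y → ι (x ℤ.- y) ≡ ι x - ι y
ι-- x y = begin
  ι (x ℤ.- y)                 ≡⟨ solve 2 (λ u v → u := (v :+ u) :- v) refl (ι (x ℤ.- y)) (ι y) ⟩
  (ι y + ι (x ℤ.- y)) - ι y   ≡⟨ cong (_- ι y) (sym (ι-+ y (x ℤ.- y))) ⟩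
  ι (y ℤ.+ (x ℤ.- y)) - ι y   ≡⟨ cong (λ t → ι t - ι y) (ℤP.+-comm y (x ℤ.- y)) ⟩
  ι (x ℤ.- y ℤ.+ y) - ι y     ≡⟨ cong (λ t → ι t - ι y) (ℤP.+-assoc x (ℤ.- y) y) ⟩
  ι (x ℤ.+ (ℤ.- y ℤ.+ y)) - ι y ≡⟨ cong (λ t → ι (x ℤ.+ t) - ι y) (ℤP.+-inverseˡ y) ⟩
  ι (x ℤ.+ ℤ.0ℤ) - ι y        ≡⟨ cong (λ t → ι t - ι y) (ℤP.+-identityʳ x) ⟩
  ι x - ι y ∎

lattice-translate : ∀ {d} {x v : Point d} → IsLattice (x ⊖ v) → IsLattice v → IsLattice x
lattice-translate {x = x} {v} (w , x-v≈w) (u , v≈u) = (λ i → w i ℤ.+ u i) , λ i → begin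
  x i                   ≡⟨ solve 2 (λ a b → a := (a :- b) :+ b) refl (x i) (v i) ⟩
  (x i - v i) + v i     ≡⟨ cong₂ _+_ (x-v≈w i) (v≈u i) ⟩
  ι (w i) + ι (u i)     ≡⟨ sym (ι-+ (w i) (u i)) ⟩
  ι (w i ℤ.+ u i)       ∎

mul-nonNeg : ∀ {a b} → 0ℚ ≤ a → 0ℚ ≤ b → 0ℚ ≤ a * b
mul-nonNeg {a} {b} 0≤a 0≤b =
  ℚP.nonNegative⁻¹ (a * b) {{ℚP.nonNeg*nonNeg⇒nonNeg a {{ℚ.nonNegative 0≤a}} b {{ℚ.nonNegative 0≤b}}}}

≤-+ʳ : ∀ a {b} → 0ℚ ≤ b → a ≤ a + b
≤-+ʳ a 0≤b = subst (_≤ a + _) (ℚP.+-identityʳ a) (ℚP.+-monoʳ-≤ a 0≤b)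

nonNeg-sum-zero : ∀ {a b} → 0ℚ ≤ a → 0ℚ ≤ b → a + b ≡ 0ℚ → a ≡ 0ℚ × b ≡ 0ℚ
nonNeg-sum-zero {a} {b} 0≤a 0≤b a+b≡0 = a≡0 , trans (sym (ℚP.+-identityˡ b)) (trans (cong (_+ b) (sym a≡0)) a+b≡0)
  where
  a≡0 : a ≡ 0ℚ
  a≡0 = ℚP.≤-antisym (subst (a ≤_) a+b≡0 (≤-+ʳ a 0≤b)) 0≤a

sumPt-coord : ∀ {d n} (f : Fin n → Point d) i → sumPt f i ≡ sumℚ (λ j → f j i)
sumPt-coord {n = ℕ.zero}  f i = refl
sumPt-coord {n = ℕ.suc n} f i = cong (λ y → f zero i + y) (sumPt-coord (tail f) i)

sumℚ-cong : ∀ {n} {f g : Fin n → ℚ} → (∀ j → f j ≡ g j) → sumℚ f ≡ sumℚ g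
sumℚ-cong {ℕ.zero}  f≡g = refl
sumℚ-cong {ℕ.suc n} f≡g = cong₂ _+_ (f≡g zero) (sumℚ-cong (λ j → f≡g (suc j)))

sumℚ-+ : ∀ {n} (f g : Fin n → ℚ) → sumℚ (λ j → f j + g j) ≡ sumℚ f + sumℚ g
sumℚ-+ {ℕ.zero}  f g = refl
sumℚ-+ {ℕ.suc n} f g =
  trans (cong (λ y → f zero + g zero + y) (sumℚ-+ (tail f) (tail g)))
        (solve 4 (λ a b c d → (a :+ b) :+ (c :+ d) := (a :+ c) :+ (b :+ d)) refl
           (f zero) (g zero) (sumℚ (tail f)) (sumℚ (tail g)))

sumℚ-* : ∀ {n} c (f : Fin n → ℚ) → sumℚ (λ j → c * f j) ≡ c * sumℚ f
sumℚ-* {ℕ.zero}  c f = sym (ℚP.*-zeroʳ c)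
sumℚ-* {ℕ.suc n} c f = trans (cong (λ y → c * f zero + y) (sumℚ-* c (tail f)))
                             (sym (ℚP.*-distribˡ-+ c (f zero) (sumℚ (tail f))))

sumℚ-nonNeg : ∀ {n} (f : Fin n → ℚ) → (∀ j → 0ℚ ≤ f j) → 0ℚ ≤ sumℚ f
sumℚ-nonNeg {ℕ.zero}  f 0≤f = ℚP.≤-refl
sumℚ-nonNeg {ℕ.suc n} f 0≤f = ℚP.+-mono-≤ (0≤f zero) (sumℚ-nonNeg (tail f) (λ j → 0≤f (suc j)))

sumℚ-zeros : ∀ {n} → sumℚ {n} (λ _ → 0ℚ) ≡ 0ℚ
sumℚ-zeros {ℕ.zero}  = refl
sumℚ-zeros {ℕ.suc n} = trans (ℚP.+-identityˡ _) (sumℚ-zeros {n})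

sumℚ-zero-weights : ∀ {n} (f x : Fin n → ℚ) → (∀ j → 0ℚ ≤ f j) → sumℚ f ≡ 0ℚ →
                    sumℚ (λ j → f j * x j) ≡ 0ℚ
sumℚ-zero-weights {ℕ.zero}  f x 0≤f Σf≡0 = refl
sumℚ-zero-weights {ℕ.suc n} f x 0≤f Σf≡0
  with nonNeg-sum-zero (0≤f zero) (sumℚ-nonNeg (tail f) (λ j → 0≤f (suc j))) Σf≡0
... | f₀≡0 , rest≡0 =
  cong₂ _+_ (trans (cong (_* x zero) f₀≡0) (ℚP.*-zeroˡ (x zero)))
            (sumℚ-zero-weights (tail f) (tail x) (λ j → 0≤f (suc j)) rest≡0)

module _ {d : ℕ} where

  combination : ∀ {n} → (Fin n → ℚ) → (Fin n → LPoint d) → Point d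
  combination λs V k = sumℚ (λ j → λs j * ι (V j k))

  mkConv : ∀ {n} (V : Fin n → LPoint d) (λs : Fin n → ℚ) x →
           (∀ j → 0ℚ ≤ λs j) → sumℚ λs ≡ 1ℚ → (∀ k → x k ≡ combination λs V k) → Conv V x
  mkConv V λs x 0≤λ Σλ≡1 x≡ = λs , 0≤λ , Σλ≡1 , λ k → trans (x≡ k) (sym (sumPt-coord (λ j → λs j · ιᵈ (V j)) k))

  Conv-coord : ∀ {n} {V : Fin n → LPoint d} {x} (cx : Conv V x) → ∀ k → x k ≡ combination (proj₁ cx) V k
  Conv-coord {V = V} (λs , _ , _ , x≈) k = trans (x≈ k) (sumPt-coord (λ j → λs j · ιᵈ (V j)) k)

  Conv-resp-≈ : ∀ {n} {V : Fin n → LPoint d} {x y} → y ≈ x → Conv V x → Conv V y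
  Conv-resp-≈ y≈x (λs , 0≤λ , Σλ≡1 , x≈) = λs , 0≤λ , Σλ≡1 , λ i → trans (y≈x i) (x≈ i)

  -- Convex hulls are convex: the weights of s·p + t·q are s·λ + t·κ.
  Conv-convex : ∀ {n} {V : Fin n → LPoint d} {p q} s t → Conv V p → Conv V q →
                0ℚ ≤ s → 0ℚ ≤ t → s + t ≡ 1ℚ → Conv V ((s · p) ⊕ (t · q))
  Conv-convex {V = V} {p} {q} s t cp@(λs , 0≤λ , Σλ≡1 , _) cq@(κs , 0≤κ , Σκ≡1 , _) 0≤s 0≤t s+t≡1 =
    mkConv V μ _ (λ j → ℚP.+-mono-≤ (mul-nonNeg 0≤s (0≤λ j)) (mul-nonNeg 0≤t (0≤κ j))) Σμ≡1 coords
    where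
    μ : Fin _ → ℚ
    μ j = s * λs j + t * κs j
    Σμ≡1 : sumℚ μ ≡ 1ℚ
    Σμ≡1 = begin
      sumℚ μ                                        ≡⟨ sumℚ-+ (λ j → s * λs j) (λ j → t * κs j) ⟩
      sumℚ (λ j → s * λs j) + sumℚ (λ j → t * κs j) ≡⟨ cong₂ _+_ (sumℚ-* s λs) (sumℚ-* t κs) ⟩
      s * sumℚ λs + t * sumℚ κs                     ≡⟨ cong₂ (λ a b → s * a + t * b) Σλ≡1 Σκ≡1 ⟩
      s * 1ℚ + t * 1ℚ                               ≡⟨ cong₂ _+_ (ℚP.*-identityʳ s) (ℚP.*-identityʳ t) ⟩
      s + t                                         ≡⟨ s+t≡1 ⟩
      1ℚ                                            ∎
    coords : ∀ k → s * p k + t * q k ≡ combination μ V k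
    coords k = begin
      s * p k + t * q k
        ≡⟨ cong₂ (λ a b → s * a + t * b) (Conv-coord {V = V} cp k) (Conv-coord {V = V} cq k) ⟩
      s * combination λs V k + t * combination κs V k
        ≡⟨ cong₂ _+_ (sym (sumℚ-* s (λ j → λs j * ι (V j k)))) (sym (sumℚ-* t (λ j → κs j * ι (V j k)))) ⟩
      sumℚ (λ j → s * (λs j * ι (V j k))) + sumℚ (λ j → t * (κs j * ι (V j k)))
        ≡⟨ sym (sumℚ-+ (λ j → s * (λs j * ι (V j k))) (λ j → t * (κs j * ι (V j k)))) ⟩
      sumℚ (λ j → s * (λs j * ι (V j k)) + t * (κs j * ι (V j k)))
        ≡⟨ sumℚ-cong (λ j → solve 5 (λ s t l c v → s :* (l :* v) :+ t :* (c :* v) := (s :* l :+ t :* c) :* v)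
                               refl s t (λs j) (κs j) (ι (V j k))) ⟩
      combination μ V k ∎

  Conv-tail⊆ : ∀ {n} (V : Fin (ℕ.suc n) → LPoint d) → Conv (tail V) ⊆ Conv V
  Conv-tail⊆ V x cx@(κs , 0≤κ , Σκ≡1 , _) = mkConv V μ x 0≤μ (trans (ℚP.+-identityˡ (sumℚ κs)) Σκ≡1) coords
    where
    μ : Fin (ℕ.suc _) → ℚ
    μ zero    = 0ℚ
    μ (suc j) = κs j
    0≤μ : ∀ j → 0ℚ ≤ μ j
    0≤μ zero    = ℚP.≤-refl
    0≤μ (suc j) = 0≤κ j
    coords : ∀ k → x k ≡ combination μ V k
    coords k = begin
      x k                                        ≡⟨ Conv-coord {V = tail V} cx k ⟩
      combination κs (tail V) k                  ≡⟨ sym (ℚP.+-identityˡ _) ⟩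
      0ℚ + combination κs (tail V) k             ≡⟨ cong (_+ combination κs (tail V) k) (sym (ℚP.*-zeroˡ (ι (V zero k)))) ⟩
      0ℚ * ι (V zero k) + combination κs (tail V) k ∎

  Conv-head : ∀ {n} (V : Fin (ℕ.suc n) → LPoint d) → Conv V (ιᵈ (V zero))
  Conv-head {n} V = mkConv V μ _ 0≤μ (cong (λ y → 1ℚ + y) (sumℚ-zeros {n})) coords
    where
    μ : Fin (ℕ.suc n) → ℚ
    μ zero    = 1ℚ
    μ (suc j) = 0ℚ
    0≤μ : ∀ j → 0ℚ ≤ μ j
    0≤μ zero    = ℚP.<⇒≤ (ℚP.positive⁻¹ 1ℚ)
    0≤μ (suc j) = ℚP.≤-refl
    coords : ∀ k → ι (V zero k) ≡ combination μ V k
    coords k = begin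
      ι (V zero k)                                   ≡⟨ sym (ℚP.*-identityˡ _) ⟩
      1ℚ * ι (V zero k)                              ≡⟨ sym (ℚP.+-identityʳ _) ⟩
      1ℚ * ι (V zero k) + 0ℚ                         ≡⟨ cong (λ y → 1ℚ * ι (V zero k) + y) (sym (sumℚ-zeros {n})) ⟩
      1ℚ * ι (V zero k) + sumℚ (λ (_ : Fin n) → 0ℚ)  ≡⟨ cong (λ y → 1ℚ * ι (V zero k) + y) (sumℚ-cong (λ j → sym (ℚP.*-zeroˡ (ι (V (suc j) k))))) ⟩
      combination μ V k                              ∎

  module HeadWeight {n} (V : Fin (ℕ.suc n) → LPoint d) {x : Point d} (cx : Conv V x) where

    λ₀ : ℚ
    λ₀ = proj₁ cx zero

    rest : Fin n → ℚ
    rest = tail (proj₁ cx)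

    0≤rest : ∀ j → 0ℚ ≤ rest j
    0≤rest j = proj₁ (proj₂ cx) (suc j)

    0≤λ₀ : 0ℚ ≤ λ₀
    0≤λ₀ = proj₁ (proj₂ cx) zero

    rest-sum : sumℚ rest ≡ 1ℚ - λ₀
    rest-sum = begin
      sumℚ rest                 ≡⟨ solve 2 (λ l r → r := (l :+ r) :- l) refl λ₀ (sumℚ rest) ⟩
      (λ₀ + sumℚ rest) - λ₀     ≡⟨ cong (_- λ₀) (proj₁ (proj₂ (proj₂ cx))) ⟩
      1ℚ - λ₀                   ∎

    λ₀≤1 : λ₀ ≤ 1ℚ
    λ₀≤1 = subst (λ₀ ≤_) (proj₁ (proj₂ (proj₂ cx))) (≤-+ʳ λ₀ (sumℚ-nonNeg rest 0≤rest))

    x-split : ∀ k → x k ≡ λ₀ * ι (V zero k) + combination rest (tail V) k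
    x-split = Conv-coord {V = V} cx

  head-weight-zero : ∀ {n} (V : Fin (ℕ.suc n) → LPoint d) {x} (cx : Conv V x) →
                     HeadWeight.λ₀ V cx ≡ 0ℚ → Conv (tail V) x
  head-weight-zero V {x} cx λ₀≡0 =
    mkConv (tail V) rest x 0≤rest (trans rest-sum (cong (λ t → 1ℚ - t) λ₀≡0)) coords
    where
    open HeadWeight V cx
    coords : ∀ k → x k ≡ combination rest (tail V) k
    coords k = begin
      x k                                                   ≡⟨ x-split k ⟩
      λ₀ * ι (V zero k) + combination rest (tail V) k
        ≡⟨ cong (_+ combination rest (tail V) k) (trans (cong (_* ι (V zero k)) λ₀≡0) (ℚP.*-zeroˡ (ι (V zero k)))) ⟩
      0ℚ + combination rest (tail V) k                      ≡⟨ ℚP.+-identityˡ _ ⟩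
      combination rest (tail V) k                           ∎

  head-weight-one : ∀ {n} (V : Fin (ℕ.suc n) → LPoint d) {x} (cx : Conv V x) →
                    HeadWeight.λ₀ V cx ≡ 1ℚ → x ≈ ιᵈ (V zero)
  head-weight-one V {x} cx λ₀≡1 k = begin
    x k                                                     ≡⟨ x-split k ⟩
    λ₀ * ι (V zero k) + combination rest (tail V) k
      ≡⟨ cong₂ _+_ (cong (_* ι (V zero k)) λ₀≡1) (sumℚ-zero-weights rest (λ j → ι (V (suc j) k)) 0≤rest rest-sum≡0) ⟩
    1ℚ * ι (V zero k) + 0ℚ                                  ≡⟨ trans (ℚP.+-identityʳ _) (ℚP.*-identityˡ _) ⟩
    ι (V zero k)                                            ∎
    where
    open HeadWeight V cx
    rest-sum≡0 : sumℚ rest ≡ 0ℚ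
    rest-sum≡0 = trans rest-sum (cong (λ t → 1ℚ - t) λ₀≡1)

  -- If 0 < λ₀ < 1, x is a proper convex combination of V₀ and a point w
  -- of the hull of the remaining generators (w has weights rest/(1 - λ₀)).
  head-weight-proper : ∀ {n} (V : Fin (ℕ.suc n) → LPoint d) {x} (cx : Conv V x) →
                       HeadWeight.λ₀ V cx < 1ℚ →
                       Σ (Point d) λ w → Conv (tail V) w ×
                         (x ≈ (HeadWeight.λ₀ V cx · ιᵈ (V zero)) ⊕ ((1ℚ - HeadWeight.λ₀ V cx) · w))
  head-weight-proper V {x} cx λ₀<1 = w , cw , x≈
    where
    open HeadWeight V cx
    D : ℚ
    D = 1ℚ - λ₀
    0<D : 0ℚ < D
    0<D = subst (_< D) (ℚP.+-inverseʳ λ₀) (ℚP.+-monoˡ-< (- λ₀) λ₀<1)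
    instance
      D≢0 : ℚ.NonZero D
      D≢0 = ℚP.pos⇒nonZero D {{ℚ.positive 0<D}}
    u : ℚ
    u = 1/ D
    0≤u : 0ℚ ≤ u
    0≤u = ℚP.<⇒≤ (ℚP.positive⁻¹ u {{ℚP.1/pos⇒pos D {{ℚ.positive 0<D}}}})
    w : Point d
    w = combination (λ j → u * rest j) (tail V)
    cw : Conv (tail V) w
    cw = mkConv (tail V) (λ j → u * rest j) w (λ j → mul-nonNeg 0≤u (0≤rest j))
           (trans (sumℚ-* u rest) (trans (cong (u *_) rest-sum) (ℚP.*-inverseˡ D)))
           (λ k → refl)
    rest≡D·w : ∀ k → combination rest (tail V) k ≡ D * w k
    rest≡D·w k = begin
      combination rest (tail V) k                   ≡⟨ sym (ℚP.*-identityˡ _) ⟩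
      1ℚ * combination rest (tail V) k              ≡⟨ cong (_* combination rest (tail V) k) (sym (ℚP.*-inverseʳ D)) ⟩
      (D * u) * combination rest (tail V) k         ≡⟨ ℚP.*-assoc D u _ ⟩
      D * (u * combination rest (tail V) k)         ≡⟨ cong (D *_) (sym (sumℚ-* u (λ j → rest j * ι (V (suc j) k)))) ⟩
      D * sumℚ (λ j → u * (rest j * ι (V (suc j) k))) ≡⟨ cong (D *_) (sumℚ-cong (λ j → sym (ℚP.*-assoc u (rest j) _))) ⟩
      D * w k                                       ∎
    x≈ : x ≈ (λ₀ · ιᵈ (V zero)) ⊕ (D · w)
    x≈ k = trans (x-split k) (cong (λ y → λ₀ * ι (V zero k) + y) (rest≡D·w k))

  -- An extreme point of a region Q ⊇ conv V that lies in conv V is one of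
  -- the generators: split off the first weight λ₀; if 0 < λ₀ < 1,
  -- extremality forces the point to be V₀, and if λ₀ = 0 recurse.
  extreme-generator : ∀ (Q : Region d) {v} → IsVertex Q v →
                      ∀ {n} (V : Fin n → LPoint d) → Conv V ⊆ Q → Conv V v →
                      Σ (Fin n) λ j → v ≈ ιᵈ (V j)
  extreme-generator Q vert {ℕ.zero} V _ (_ , _ , 0≡1 , _) = ⊥-elim (ℚP.1≢0 (sym 0≡1))
  extreme-generator Q vert {ℕ.suc n} V hull⊆Q cv
    with ℚP.<-cmp 0ℚ (HeadWeight.λ₀ V cv) | ℚP.<-cmp (HeadWeight.λ₀ V cv) 1ℚ
  ... | tri≈ _ 0≡λ₀ _ | _ =
    let (j , v≈Vj) = extreme-generator Q vert (tail V) (λ y → hull⊆Q y ∘ Conv-tail⊆ V y)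
                                         (head-weight-zero V cv (sym 0≡λ₀))
    in suc j , v≈Vj
  ... | tri< _ _ _ | tri≈ _ λ₀≡1 _ = zero , head-weight-one V cv λ₀≡1
  ... | tri< 0<λ₀ _ _ | tri< λ₀<1 _ _ =
    let (w , cw , v≈) = head-weight-proper V cv λ₀<1
    in zero , λ k → sym (proj₂ vert (ιᵈ (V zero)) w _ (hull⊆Q _ (Conv-head V))
                                    (hull⊆Q w (Conv-tail⊆ V w cw)) 0<λ₀ λ₀<1 v≈ k)
  ... | tri< _ _ _ | tri> _ _ 1<λ₀ = ⊥-elim (ℚP.<-irrefl refl (ℚP.≤-<-trans (HeadWeight.λ₀≤1 V cv) 1<λ₀))
  ... | tri> _ _ λ₀<0 | _ = ⊥-elim (ℚP.<-irrefl refl (ℚP.≤-<-trans (HeadWeight.0≤λ₀ V cv) λ₀<0))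

⋆-resp-≈ : ∀ {d} {P : Region d} {c x y} → y ≈ x → (c ⋆ P) x → (c ⋆ P) y
⋆-resp-≈ y≈x (q , Pq , x≈cq) = q , Pq , λ i → trans (y≈x i) (x≈cq i)

unit-dilation : ∀ {d n} (V : Fin n → LPoint d) → (1ℚ ⋆ Conv V) ≐ Conv V
unit-dilation V =
  (λ x (q , cq , x≈1q) → Conv-resp-≈ {V = V} (λ i → trans (x≈1q i) (ℚP.*-identityˡ (q i))) cq) ,
  (λ x cx → x , cx , λ i → sym (ℚP.*-identityˡ (x i)))

-- For p, b in the hull, m·p + b lies in (m+1)·hull: it is m+1 times the
-- convex combination (m/(m+1))·p + (1/(m+1))·b.
dilate-combination : ∀ {d n} (V : Fin n → LPoint d) m {p b} → Conv V p → Conv V b →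
                     (ι (+ ℕ.suc m) ⋆ Conv V) ((ι (+ m) · p) ⊕ b)
dilate-combination V m {p} {b} cp cb =
  ((M * u) · p) ⊕ (u · b) ,
  Conv-convex {V = V} (M * u) u cp cb (mul-nonNeg 0≤M 0≤u) 0≤u Mu+u≡1 ,
  coords
  where
  M K : ℚ
  M = ι (+ m)
  K = ι (+ ℕ.suc m)
  instance
    K-pos : ℚ.Positive K
    K-pos = ℚP.normalize-pos (ℕ.suc m) 1
    K≢0 : ℚ.NonZero K
    K≢0 = ℚP.pos⇒nonZero K
  u : ℚ
  u = 1/ K
  0≤M : 0ℚ ≤ M
  0≤M = ℚP.nonNegative⁻¹ M {{ℚP.normalize-nonNeg m 1}}
  0≤u : 0ℚ ≤ u
  0≤u = ℚP.<⇒≤ (ℚP.positive⁻¹ u {{ℚP.1/pos⇒pos K}})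
  Mu+u≡1 : M * u + u ≡ 1ℚ
  Mu+u≡1 = begin
    M * u + u      ≡⟨ solve 2 (λ x y → x :* y :+ y := (x :+ con 1ℚ) :* y) refl M u ⟩
    (M + 1ℚ) * u   ≡⟨ cong (_* u) (sym (ι-suc m)) ⟩
    K * u          ≡⟨ ℚP.*-inverseʳ K ⟩
    1ℚ             ∎
  coords : ∀ i → M * p i + b i ≡ K * ((M * u) * p i + u * b i)
  coords i = begin
    M * p i + b i                  ≡⟨ sym (ℚP.*-identityˡ _) ⟩
    1ℚ * (M * p i + b i)           ≡⟨ cong (_* (M * p i + b i)) (sym (ℚP.*-inverseʳ K)) ⟩
    (K * u) * (M * p i + b i)
      ≡⟨ solve 5 (λ k u m p b → (k :* u) :* (m :* p :+ b) := k :* ((m :* u) :* p :+ u :* b)) refl K u M (p i) (b i) ⟩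
    K * ((M * u) * p i + u * b i)  ∎

-- Points of G(P) for a lattice polytope P are lattice points of P: they
-- differ by a lattice vector from a vertex, and vertices are generators.
G-lattice : ∀ {d n} (V : Fin n → LPoint d) {a} → G (1ℚ ⋆ Conv V) a → Conv V a × IsLattice a
G-lattice V (a∈1P , v , vert , a-v-lattice) =
  proj₁ (unit-dilation V) _ a∈1P ,
  lattice-translate a-v-lattice (V (proj₁ v-generator) , proj₂ v-generator)
  where
  v-generator : Σ (Fin _) λ j → v ≈ ιᵈ (V j)
  v-generator = extreme-generator (1ℚ ⋆ Conv V) vert V (proj₂ (unit-dilation V))
                                  (proj₁ (unit-dilation V) v (proj₁ vert))

Peeling : ∀ {d} → Region d → ℕ → LPoint d → Set
Peeling {d} P m z = Σ (LPoint d) λ g → Σ (LPoint d) λ z' →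
  P (ιᵈ g) × (ι (+ ℕ.suc m) ⋆ P) (ιᵈ z') × (ιᵈ z ≈ ιᵈ g ⊕ ιᵈ z')

Peelable : ∀ {d} → Region d → Set
Peelable {d} P = ∀ m (z : LPoint d) → (ι (+ ℕ.suc (ℕ.suc m)) ⋆ P) (ιᵈ z) → Peeling P m z

peel-arith : ∀ M p a b → (1ℚ + 1ℚ) * p ≡ a + b → (M + 1ℚ + 1ℚ) * p - a ≡ M * p + b
peel-arith M p a b 2p≡a+b = begin
  (M + 1ℚ + 1ℚ) * p - a         ≡⟨ solve 3 (λ m p a → (m :+ con 1ℚ :+ con 1ℚ) :* p :- a
                                                     := m :* p :+ ((con 1ℚ :+ con 1ℚ) :* p :- a)) refl M p a ⟩
  M * p + ((1ℚ + 1ℚ) * p - a)   ≡⟨ cong (λ y → M * p + (y - a)) 2p≡a+b ⟩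
  M * p + ((a + b) - a)         ≡⟨ cong (λ y → M * p + y) (solve 2 (λ a b → (a :+ b) :- a := b) refl a b) ⟩
  M * p + b                     ∎

-- 2-convex-normality peels: write z = (m+2)p and 2p = a + b with a ∈ G(P),
-- b ∈ P; then a is a lattice point of P and z - a = m·p + b ∈ (m+1)P.
convexNormal⇒peelable : ∀ {d n} (V : Fin n → LPoint d) →
                        ConvexNormal (+ 2 / 1) (Conv V) → Peelable (Conv V)
convexNormal⇒peelable V normal m z (p , cp , z≈) =
  peel (proj₁ (normal (+ 2 / 1) ℚP.≤-refl ℚP.≤-refl) ((+ 2 / 1) · p) (p , cp , λ i → refl))
  where
  peel : (G (1ℚ ⋆ Conv V) ⊞ Conv V) ((+ 2 / 1) · p) → Peeling (Conv V) m z
  peel (a , b , a∈G , cb , 2p≈a+b) =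
    g , z' , Conv-resp-≈ {V = V} (λ i → sym (a≈g i)) (proj₁ a-lattice) ,
    ⋆-resp-≈ {c = ι (+ ℕ.suc m)} z'≈ (dilate-combination V m cp cb) , z-split
    where
    a-lattice : Conv V a × IsLattice a
    a-lattice = G-lattice V a∈G
    g : LPoint _
    g = proj₁ (proj₂ a-lattice)
    a≈g : a ≈ ιᵈ g
    a≈g = proj₂ (proj₂ a-lattice)
    M : ℚ
    M = ι (+ m)
    z' : LPoint _
    z' i = z i ℤ.- g i
    z-split : ιᵈ z ≈ ιᵈ g ⊕ ιᵈ z'
    z-split i = begin
      ι (z i)                          ≡⟨ solve 2 (λ x y → x := y :+ (x :- y)) refl (ι (z i)) (ι (g i)) ⟩
      ι (g i) + (ι (z i) - ι (g i))    ≡⟨ cong (λ y → ι (g i) + y) (sym (ι-- (z i) (g i))) ⟩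
      ι (g i) + ι (z' i)               ∎
    z'≈ : ιᵈ z' ≈ (M · p) ⊕ b
    z'≈ i = begin
      ι (z' i)                     ≡⟨ ι-- (z i) (g i) ⟩
      ι (z i) - ι (g i)            ≡⟨ cong₂ _-_ (z≈ i) (sym (a≈g i)) ⟩
      ι (+ ℕ.suc (ℕ.suc m)) * p i - a i
        ≡⟨ cong (λ k → k * p i - a i) (trans (ι-suc (ℕ.suc m)) (cong (_+ 1ℚ) (ι-suc m))) ⟩
      (M + 1ℚ + 1ℚ) * p i - a i    ≡⟨ peel-arith M (p i) (a i) (b i) (2p≈a+b i) ⟩
      M * p i + b i                ∎

peelable⇒IDP : ∀ {d} (P : Region d) → (1ℚ ⋆ P) ⊆ P → Peelable P → IDP P
peelable⇒IDP {d} P unit⊆ peel (ℕ.suc k) _ = decompose k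
  where
  decompose : ∀ m (z : LPoint d) → (ι (+ ℕ.suc m) ⋆ P) (ιᵈ z) →
              Σ (Fin (ℕ.suc m) → LPoint d) λ xs →
                (∀ i → P (ιᵈ (xs i))) × (ιᵈ z ≈ sumPt (λ i → ιᵈ (xs i)))
  decompose ℕ.zero z z∈P = (λ _ → z) , (λ _ → unit⊆ _ z∈P) , λ i → sym (ℚP.+-identityʳ (ι (z i)))
  decompose (ℕ.suc m) z z∈ with peel m z z∈
  ... | g , z' , g∈P , z'∈ , z≈g+z' with decompose m z' z'∈
  ... | xs , xs∈P , z'≈Σxs =
    (g ∷ xs) , (λ { zero → g∈P ; (suc i) → xs∈P i }) ,
    λ i → trans (z≈g+z' i) (cong (λ y → ι (g i) + y) (z'≈Σxs i))

mainTheorem2 : (d n : ℕ) (V : Fin n → LPoint d) → ConvexNormal (+ 2 / 1) (Conv V) → IDP (Conv V)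
mainTheorem2 d n V normal =
  peelable⇒IDP (Conv V) (proj₁ (unit-dilation V)) (convexNormal⇒peelable V normal)
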